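{- There exist constants $c> 1$ and $C>0$ such that for all integers $n\ge 2$ and $k\ge 1$, $\mathrm{rank}_{\mathbb{B}}(C_n^{\otimes k}) \leq C\, c^k \cdot \mathrm{rank}_{\mathbb{B}}(C_n)$.
   Context: $C_n$ is the $n\times n$ $0,1$ matrix with zeros on the main diagonal and ones elsewhere. For matrices $A$ ($n\times m$) and $B$, the Kronecker product $A\otimes B$ is the block matrix whose $(i,j)$ block is $A_{i,j}\cdot B$; $M^{\otimes 1}=M$, $M^{\otimes k}=M\otimes M^{\otimes(k-1)}$. The Boolean rank $\mathrm{rank}_{\mathbb{B}}(N)$ of a $0,1$ matrix $N$ is the minimal $r$ with $N=A\cdot B$ for $0,1$ matrices $A,B$ of inner dimension $r$ under Boolean arithmetic ($1+1=1$); equivalently the minimum number of all-ones submatrices covering the $1$-entries of $N$. -}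

module Defs where

open import Data.Bool using (Bool; true; false; _∧_; _∨_; not)
open import Data.Nat as ℕ using (ℕ; zero; suc; _*_)
open import Data.Fin using (Fin; zero; suc; remQuot; _≟_)
open import Data.Product using (Σ; _×_; _,_; proj₁; proj₂)
open import Relation.Nullary.Decidable using (⌊_⌋)
open import Relation.Binary.PropositionalEquality using (_≡_)
open import Data.Rational as ℚ using (ℚ; 1ℚ)
open import Data.Integer using (+_)

Mat : ℕ → ℕ → Set
Mat m n = Fin m → Fin n → Bool

bigOr : (r : ℕ) → (Fin r → Bool) → Bool
bigOr zero    f = false
bigOr (suc r) f = f zero ∨ bigOr r (λ l → f (suc l))

_⊙_ : ∀ {m r n} → Mat m r → Mat r n → Mat m n
(A ⊙ B) i j = bigOr _ (λ l → A i l ∧ B l j)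

BoolFactors : ∀ {m n} → Mat m n → ℕ → Set
BoolFactors {m} {n} N r =
  Σ (Mat m r) λ A → Σ (Mat r n) λ B → ∀ i j → N i j ≡ (A ⊙ B) i j

HasBoolRank : ∀ {m n} → Mat m n → ℕ → Set
HasBoolRank N r = BoolFactors N r × (∀ s → BoolFactors N s → r ℕ.≤ s)

Cmat : (n : ℕ) → Mat n n
Cmat n i j = not ⌊ i ≟ j ⌋

-- Kronecker product: the (i,j) block is A i j · B; row index i*p + i'
_⊗_ : ∀ {m m' p p'} → Mat m m' → Mat p p' → Mat (m * p) (m' * p')
_⊗_ {m} {m'} {p} {p'} A B x y =
  A (proj₁ (remQuot {m} p x)) (proj₁ (remQuot {m'} p' y)) ∧
  B (proj₂ (remQuot {m} p x)) (proj₂ (remQuot {m'} p' y))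

kdim : ℕ → ℕ → ℕ
kdim n zero    = n
kdim n (suc k) = n * kdim n k

-- kronPow M k = M^{⊗(k+1)} :  M^{⊗1} = M,  M^{⊗(k+2)} = M ⊗ M^{⊗(k+1)}
kronPow : ∀ {n} → Mat n n → (k : ℕ) → Mat (kdim n k) (kdim n k)
kronPow M zero    = M
kronPow M (suc k) = M ⊗ kronPow M k

toℚ : ℕ → ℚ
toℚ r = + r ℚ./ 1

_^ℚ_ : ℚ → ℕ → ℚ
q ^ℚ zero  = 1ℚ
q ^ℚ suc k = q ℚ.* (q ^ℚ k)

-- A set S ⊆ [n] gives the all-ones rectangle ([n] ∖ S) × S of C_n, and for a uniformly random S
-- each 1-entry (x, y) of C_n lies in it with probability 1/4. Kronecker products of such rectangles
-- are rectangles of C_n^{⊗k} covering each 1-entry with probability 4^{-k}, a fractional cover of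
-- weight D = 4^k. Rounding it greedily, some rectangle always covers a 1/D fraction of the
-- still uncovered 1-entries, and (1 - 1/D)^D ≤ 1/2, so D·t rectangles cover any matrix with fewer
-- than 2^t ones. In a factorization C_n = A · B of inner dimension r the n rows of A are distinct,
-- so n ≤ 2^r; hence C_n^{⊗k} has at most 2^{2rk} ones and rank_B(C_n^{⊗k}) ≤ 4^k (2rk + 1) ≤ 3 · 8^k · r.
module Submission where

open import Algebra.Bundles using (CommutativeMonoid)
open import Data.Bool using (Bool; true; false; _∧_; _∨_; not)
open import Data.Bool.Properties using (∧-commutativeMonoid; ∧-inverseˡ; ∧-identityʳ; ∧-zeroʳ)
open import Data.Fin using (Fin; zero; suc; remQuot; combine; quotient; remainder; _↑ˡ_; _↑ʳ_; finToFun; funToFin; _≟_)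
open import Data.Fin.Properties using (remQuot-combine; finToFun-funToFin; injective⇒≤; 2↔Bool)
import Data.Integer as ℤ
import Data.Integer.Properties as ℤP
open import Data.Nat as ℕ using (ℕ; zero; suc; _+_; _*_; _^_; _≤_; _<_; z≤n; s≤s; NonZero; >-nonZero⁻¹)
open import Data.Nat.Coprimality using (1-coprimeTo) renaming (sym to coprime-sym)
open import Data.Nat.Properties hiding (_≟_)
open import Data.Nat.Tactic.RingSolver using (solve-∀)
open import Data.Product using (Σ; _×_; _,_; proj₁; proj₂; ∃)
open import Data.Rational as ℚ using (ℚ; 0ℚ; 1ℚ; mkℚ)
import Data.Rational.Properties as ℚP
open import Data.Unit using (tt)
open import Data.Vec.Functional using (_∷_)
open import Defs
open import Function using (_∘_; flip; Inverse)
open import Relation.Binary.PropositionalEquality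
open import Relation.Nullary using (yes; no; contradiction)
open import Relation.Nullary.Decidable using (isYes≗does; dec-true; dec-false; toWitness)

open import Algebra.Properties.Semiring.Sum +-*-semiring
  using (sum; sum-syntax; sum-cong-≗; ∑-comm; ∑-distrib-+; *-distribˡ-sum; *-distribʳ-sum)
open import Algebra.Properties.CommutativeSemigroup (CommutativeMonoid.commutativeSemigroup ∧-commutativeMonoid)
  using () renaming (interchange to ∧-interchange)
open import Algebra.Properties.CommutativeSemigroup +-commutativeSemigroup
  using () renaming (interchange to +-interchange)
open import Algebra.Properties.CommutativeSemigroup *-commutativeSemigroup
  using (x∙yz≈y∙xz) renaming (interchange to *-interchange)

⟦_⟧ : Bool → ℕ
⟦ true  ⟧ = 1
⟦ false ⟧ = 0

⟦⟧≤1 : ∀ b → ⟦ b ⟧ ≤ 1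
⟦⟧≤1 true  = ≤-refl
⟦⟧≤1 false = z≤n

⟦∧⟧ : ∀ a b → ⟦ a ∧ b ⟧ ≡ ⟦ a ⟧ * ⟦ b ⟧
⟦∧⟧ true  b = sym (+-identityʳ ⟦ b ⟧)
⟦∧⟧ false b = refl

⟦∧⟧-interchange : ∀ a a′ b b′ → ⟦ (a ∧ a′) ∧ (b ∧ b′) ⟧ ≡ ⟦ a ∧ b ⟧ * ⟦ a′ ∧ b′ ⟧
⟦∧⟧-interchange a a′ b b′ = trans (cong ⟦_⟧ (∧-interchange a a′ b b′)) (⟦∧⟧ (a ∧ b) (a′ ∧ b′))

∧-true⁻ : ∀ {a b} → a ∧ b ≡ true → a ≡ true × b ≡ true
∧-true⁻ {true} {true} _ = refl , refl

bigOr-cong : ∀ {r} {f g : Fin r → Bool} → (∀ l → f l ≡ g l) → bigOr r f ≡ bigOr r g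
bigOr-cong {zero}  _   = refl
bigOr-cong {suc r} f≗g = cong₂ _∨_ (f≗g zero) (bigOr-cong (f≗g ∘ suc))

bigOr-true : ∀ r (f : Fin r → Bool) → bigOr r f ≡ true → ∃ λ l → f l ≡ true
bigOr-true (suc r) f any-f with f zero in f₀
... | true  = zero , f₀
... | false = let l , fl = bigOr-true r (f ∘ suc) any-f in suc l , fl

∑-mono-≤ : ∀ {n} {f g : Fin n → ℕ} → (∀ i → f i ≤ g i) → sum f ≤ sum g
∑-mono-≤ {zero}  _   = z≤n
∑-mono-≤ {suc n} f≤g = +-mono-≤ (f≤g zero) (∑-mono-≤ (f≤g ∘ suc))

∑-const : ∀ n c → ∑[ i < n ] c ≡ n * c
∑-const zero    c = refl
∑-const (suc n) c = cong (c +_) (∑-const n c)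

∑-≤-* : ∀ {n c} {f : Fin n → ℕ} → (∀ i → f i ≤ c) → sum f ≤ n * c
∑-≤-* {n} {c} f≤c = ≤-trans (∑-mono-≤ f≤c) (≤-reflexive (∑-const n c))

≤-∑ : ∀ {n} (f : Fin n → ℕ) i → f i ≤ sum f
≤-∑ f zero    = m≤m+n (f zero) _
≤-∑ f (suc i) = ≤-trans (≤-∑ (f ∘ suc) i) (m≤n+m _ (f zero))

∑-↑ : ∀ m {n} (f : Fin (m + n) → ℕ) → sum f ≡ ∑[ i < m ] f (i ↑ˡ n) + ∑[ j < n ] f (m ↑ʳ j)
∑-↑ zero    f = refl
∑-↑ (suc m) f = trans (cong (f zero +_) (∑-↑ m (f ∘ suc))) (sym (+-assoc (f zero) _ _))

∑-combine : ∀ m {n} (f : Fin (m * n) → ℕ) → sum f ≡ ∑[ i < m ] ∑[ j < n ] f (combine i j)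
∑-combine zero    f = refl
∑-combine (suc m) {n} f =
  trans (∑-↑ n f) (cong (∑[ j < n ] f (j ↑ˡ m * n) +_) (∑-combine m (f ∘ (n ↑ʳ_))))

∑-remQuot : ∀ m {n} (f : Fin m × Fin n → ℕ) →
            ∑[ k < m * n ] f (remQuot n k) ≡ ∑[ i < m ] ∑[ j < n ] f (i , j)
∑-remQuot m f = trans (∑-combine m _)
  (sum-cong-≗ λ i → sum-cong-≗ λ j → cong f (remQuot-combine i j))

max-≥-mean : ∀ {K} .{{_ : NonZero K}} t (f : Fin K → ℕ) → t * K ≤ sum f → ∃ λ l → t ≤ f l
max-≥-mean {suc K} = go K
  where
  go : ∀ K t (f : Fin (suc K) → ℕ) → t * suc K ≤ sum f → ∃ λ l → t ≤ f l
  go zero t f tK≤∑ = zero , (begin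
    t               ≡⟨ *-identityʳ t ⟨
    t * 1           ≤⟨ tK≤∑ ⟩
    f zero + 0      ≡⟨ +-identityʳ (f zero) ⟩
    f zero          ∎)
    where open ≤-Reasoning
  go (suc K) t f tK≤∑ with t ≤? f zero
  ... | yes t≤f₀ = zero , t≤f₀
  ... | no  t≰f₀ = let l , t≤fl = go K t (f ∘ suc) (+-cancelˡ-≤ t _ _ rest) in suc l , t≤fl
    where
    open ≤-Reasoning
    rest : t + t * suc K ≤ t + sum (f ∘ suc)
    rest = begin
      t + t * suc K            ≡⟨ *-suc t (suc K) ⟨
      t * suc (suc K)          ≤⟨ tK≤∑ ⟩
      f zero + sum (f ∘ suc)   ≤⟨ +-monoˡ-≤ _ (<⇒≤ (≰⇒> t≰f₀)) ⟩
      t + sum (f ∘ suc)        ∎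

^-distribʳ-* : ∀ x y t → (x * y) ^ t ≡ x ^ t * y ^ t
^-distribʳ-* x y zero    = refl
^-distribʳ-* x y (suc t) = trans (cong (x * y *_) (^-distribʳ-* x y t)) (*-interchange x y (x ^ t) (y ^ t))

n<2^n : ∀ n → n < 2 ^ n
n<2^n zero    = s≤s z≤n
n<2^n (suc n) = ≤-trans (+-mono-≤ (m^n>0 2 n) (n<2^n n)) (≤-reflexive (cong (2 ^ n +_) (sym (+-identityʳ (2 ^ n)))))

bernoulli : ∀ a m → a ^ m * (a + m) ≤ a * suc a ^ m
bernoulli a zero    = ≤-reflexive (trans (+-identityʳ (a + 0)) (trans (+-identityʳ a) (sym (*-identityʳ a))))
bernoulli a (suc m) = begin
  a ^ suc m * (a + suc m)    ≡⟨ *-assoc a (a ^ m) _ ⟩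
  a * (a ^ m * (a + suc m))  ≡⟨ x∙yz≈y∙xz a (a ^ m) _ ⟩
  a ^ m * (a * (a + suc m))  ≤⟨ *-monoʳ-≤ (a ^ m) (≤-trans (m≤m+n _ m) (≤-reflexive (step a m))) ⟩
  a ^ m * (suc a * (a + m))  ≡⟨ x∙yz≈y∙xz (a ^ m) (suc a) _ ⟩
  suc a * (a ^ m * (a + m))  ≤⟨ *-monoʳ-≤ (suc a) (bernoulli a m) ⟩
  suc a * (a * suc a ^ m)    ≡⟨ x∙yz≈y∙xz (suc a) a _ ⟩
  a * suc a ^ suc m          ∎
  where
  open ≤-Reasoning
  step : ∀ a m → a * (a + suc m) + m ≡ suc a * (a + m)
  step = solve-∀

2*a^[1+a]≤[1+a]^[1+a] : ∀ a → 2 * a ^ suc a ≤ suc a ^ suc a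
2*a^[1+a]≤[1+a]^[1+a] a = begin
  2 * (a * a ^ a)     ≡⟨ rearrange a (a ^ a) ⟩
  a ^ a * (a + a)     ≤⟨ bernoulli a a ⟩
  a * suc a ^ a       ≤⟨ *-monoˡ-≤ (suc a ^ a) (n≤1+n a) ⟩
  suc a * suc a ^ a   ∎
  where
  open ≤-Reasoning
  rearrange : ∀ a P → 2 * (a * P) ≡ P * (a + a)
  rearrange = solve-∀

a^[[1+a]t]*2^t≤[1+a]^[[1+a]t] : ∀ a t → a ^ (suc a * t) * 2 ^ t ≤ suc a ^ (suc a * t)
a^[[1+a]t]*2^t≤[1+a]^[[1+a]t] a t = begin
  a ^ (suc a * t) * 2 ^ t      ≡⟨ cong (_* 2 ^ t) (^-*-assoc a (suc a) t) ⟨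
  (a ^ suc a) ^ t * 2 ^ t      ≡⟨ ^-distribʳ-* (a ^ suc a) 2 t ⟨
  (a ^ suc a * 2) ^ t          ≤⟨ ^-monoˡ-≤ t (≤-trans (≤-reflexive (*-comm (a ^ suc a) 2)) (2*a^[1+a]≤[1+a]^[1+a] a)) ⟩
  (suc a ^ suc a) ^ t          ≡⟨ ^-*-assoc (suc a) (suc a) t ⟩
  suc a ^ (suc a * t)          ∎
  where open ≤-Reasoning

p*u≤q*v<q*w≤p⇒u≡0 : ∀ {p q u v w} → .{{NonZero p}} → p * u ≤ q * v → v < w → q * w ≤ p → u ≡ 0
p*u≤q*v<q*w≤p⇒u≡0 {u = zero} _ _ _ = refl
p*u≤q*v<q*w≤p⇒u≡0 {p} {zero} {suc u} pu≤0 _ _ =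
  contradiction (≤-trans (m≤m*n p (suc u)) pu≤0) (<⇒≱ (>-nonZero⁻¹ p))
p*u≤q*v<q*w≤p⇒u≡0 {p} {suc q} {suc u} pu≤qv v<w qw≤p =
  contradiction (≤-<-trans (≤-trans (m≤m*n p (suc u)) pu≤qv) (<-≤-trans (*-monoʳ-< (suc q) v<w) qw≤p)) (<-irrefl refl)

4^K*[1+2rK]≤3*8^K*r : ∀ r K → 1 ≤ r → 1 ≤ K → 4 ^ K * suc (r * K + r * K) ≤ 3 * 8 ^ K * r
4^K*[1+2rK]≤3*8^K*r r K 1≤r 1≤K = begin
  4 ^ K * suc (E + E)        ≤⟨ *-monoʳ-≤ (4 ^ K) (+-monoˡ-≤ (E + E) (*-mono-≤ 1≤r 1≤K)) ⟩
  4 ^ K * (E + (E + E))      ≡⟨ cong (4 ^ K *_) (triple r K) ⟩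
  4 ^ K * (3 * r * K)        ≤⟨ *-monoʳ-≤ (4 ^ K) (*-monoʳ-≤ (3 * r) (<⇒≤ (n<2^n K))) ⟩
  4 ^ K * (3 * r * 2 ^ K)    ≡⟨ rearrange (4 ^ K) (2 ^ K) r ⟩
  3 * (4 ^ K * 2 ^ K) * r    ≡⟨ cong (λ c → 3 * c * r) (^-distribʳ-* 4 2 K) ⟨
  3 * 8 ^ K * r              ∎
  where
  open ≤-Reasoning
  E = r * K
  triple : ∀ r K → r * K + (r * K + r * K) ≡ 3 * r * K
  triple = solve-∀
  rearrange : ∀ F T r → F * (3 * r * T) ≡ 3 * (F * T) * r
  rearrange = solve-∀

module _ {m n : ℕ} where

  ones : Mat m n → ℕ
  ones U = ∑[ x < m ] ∑[ y < n ] ⟦ U x y ⟧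

  _∩_ _∖_ : Mat m n → Mat m n → Mat m n
  (U ∩ V) x y = U x y ∧ V x y
  (U ∖ V) x y = U x y ∧ not (V x y)

  _⊆_ : Mat m n → Mat m n → Set
  U ⊆ V = ∀ x y → U x y ≡ true → V x y ≡ true

  ones-cong : ∀ {U V : Mat m n} → (∀ x y → U x y ≡ V x y) → ones U ≡ ones V
  ones-cong U≡V = sum-cong-≗ λ x → sum-cong-≗ λ y → cong ⟦_⟧ (U≡V x y)

  ones-≤ : ∀ (U : Mat m n) → ones U ≤ m * n
  ones-≤ U = ∑-≤-* λ x → ≤-trans (∑-≤-* λ y → ⟦⟧≤1 (U x y)) (≤-reflexive (*-identityʳ n))

  ones-pos : ∀ (U : Mat m n) x y → U x y ≡ true → 0 < ones U
  ones-pos U x y Uxy = begin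
    1                        ≡⟨ cong ⟦_⟧ Uxy ⟨
    ⟦ U x y ⟧                ≤⟨ ≤-∑ _ y ⟩
    ∑[ y < n ] ⟦ U x y ⟧     ≤⟨ ≤-∑ _ x ⟩
    ones U                   ∎
    where open ≤-Reasoning

  ones-∖-∩ : ∀ (U V : Mat m n) → ones U ≡ ones (U ∖ V) + ones (U ∩ V)
  ones-∖-∩ U V = begin
    ones U                                                                ≡⟨ sum-cong-≗ (λ x → sum-cong-≗ (split x)) ⟩
    ∑[ x < m ] ∑[ y < n ] (⟦ (U ∖ V) x y ⟧ + ⟦ (U ∩ V) x y ⟧)           ≡⟨ sum-cong-≗ (λ x → ∑-distrib-+ (λ y → ⟦ (U ∖ V) x y ⟧) _) ⟩
    ∑[ x < m ] (∑[ y < n ] ⟦ (U ∖ V) x y ⟧ + ∑[ y < n ] ⟦ (U ∩ V) x y ⟧) ≡⟨ ∑-distrib-+ (λ x → ∑[ y < n ] ⟦ (U ∖ V) x y ⟧) _ ⟩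
    ones (U ∖ V) + ones (U ∩ V)                                           ∎
    where
    open ≡-Reasoning
    split : ∀ x y → ⟦ U x y ⟧ ≡ ⟦ (U ∖ V) x y ⟧ + ⟦ (U ∩ V) x y ⟧
    split x y with U x y | V x y
    ... | false | _     = refl
    ... | true  | false = refl
    ... | true  | true  = refl

module _ {m K n : ℕ} where

  rect : Mat m K → Mat K n → Fin K → Mat m n
  rect A B l x y = A x l ∧ B l y

  coverCount : Mat m K → Mat K n → Fin m → Fin n → ℕ
  coverCount A B x y = ∑[ l < K ] ⟦ rect A B l x y ⟧

  ∑-ones-∩-rect : ∀ (U : Mat m n) (A : Mat m K) (B : Mat K n) →
                  ∑[ l < K ] ones (U ∩ rect A B l) ≡ ∑[ x < m ] ∑[ y < n ] (⟦ U x y ⟧ * coverCount A B x y)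
  ∑-ones-∩-rect U A B = begin
    ∑[ l < K ] ∑[ x < m ] ∑[ y < n ] ⟦ U x y ∧ rect A B l x y ⟧      ≡⟨ ∑-comm (λ l x → ∑[ y < n ] ⟦ U x y ∧ rect A B l x y ⟧) ⟩
    ∑[ x < m ] ∑[ l < K ] ∑[ y < n ] ⟦ U x y ∧ rect A B l x y ⟧      ≡⟨ sum-cong-≗ (λ x → ∑-comm (λ l y → ⟦ U x y ∧ rect A B l x y ⟧)) ⟩
    ∑[ x < m ] ∑[ y < n ] ∑[ l < K ] ⟦ U x y ∧ rect A B l x y ⟧      ≡⟨ sum-cong-≗ (λ x → sum-cong-≗ λ y →
                                                                          sum-cong-≗ λ l → ⟦∧⟧ (U x y) (rect A B l x y)) ⟩
    ∑[ x < m ] ∑[ y < n ] ∑[ l < K ] (⟦ U x y ⟧ * ⟦ rect A B l x y ⟧) ≡⟨ sum-cong-≗ (λ x → sum-cong-≗ λ y →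
                                                                          *-distribˡ-sum ⟦ U x y ⟧ (λ l → ⟦ rect A B l x y ⟧)) ⟨
    ∑[ x < m ] ∑[ y < n ] (⟦ U x y ⟧ * coverCount A B x y)           ∎
    where open ≡-Reasoning

module _ {m K n p K′ n′ : ℕ} (A : Mat m K) (B : Mat K n) (A′ : Mat p K′) (B′ : Mat K′ n′) where

  coverCount-⊗ : ∀ x y → coverCount (A ⊗ A′) (B ⊗ B′) x y ≡
                 coverCount A B (quotient {m} p x) (quotient {n} n′ y) *
                 coverCount A′ B′ (remainder {m} p x) (remainder {n} n′ y)
  coverCount-⊗ x y = begin
    ∑[ l < K * K′ ] F (remQuot {K} K′ l)                                ≡⟨ ∑-remQuot K F ⟩
    ∑[ i < K ] ∑[ j < K′ ] F (i , j)                                    ≡⟨ sum-cong-≗ (λ i → sum-cong-≗ λ j →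
                                                                            ⟦∧⟧-interchange (A x₁ i) (A′ x₂ j) (B i y₁) (B′ j y₂)) ⟩
    ∑[ i < K ] ∑[ j < K′ ] (⟦ rect A B i x₁ y₁ ⟧ * ⟦ rect A′ B′ j x₂ y₂ ⟧) ≡⟨ sum-cong-≗ (λ i →
                                                                            *-distribˡ-sum ⟦ rect A B i x₁ y₁ ⟧ (λ j → ⟦ rect A′ B′ j x₂ y₂ ⟧)) ⟨
    ∑[ i < K ] (⟦ rect A B i x₁ y₁ ⟧ * coverCount A′ B′ x₂ y₂)           ≡⟨ *-distribʳ-sum (coverCount A′ B′ x₂ y₂) (λ i → ⟦ rect A B i x₁ y₁ ⟧) ⟨
    coverCount A B x₁ y₁ * coverCount A′ B′ x₂ y₂                          ∎
    where
    open ≡-Reasoning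
    x₁ = quotient {m} p x
    x₂ = remainder {m} p x
    y₁ = quotient {n} n′ y
    y₂ = remainder {n} n′ y
    F : Fin K × Fin K′ → ℕ
    F ij = ⟦ (A x₁ (proj₁ ij) ∧ A′ x₂ (proj₂ ij)) ∧ (B (proj₁ ij) y₁ ∧ B′ (proj₂ ij) y₂) ⟧

-- Fractional covers

-- The uniform distribution on the rectangles rect rows cols l covers every 1-entry of M
-- with probability at least 1/D.
record FractionalCover {m n} (M : Mat m n) (D : ℕ) : Set where
  field
    size     : ℕ
    nonEmpty : NonZero size
    rows     : Mat m size
    cols     : Mat size n
    inside   : ∀ l → rect rows cols l ⊆ M
    dense    : ∀ x y → M x y ≡ true → size ≤ D * coverCount rows cols x y

_⊗ᶠ_ : ∀ {m n p q} {M : Mat m n} {N : Mat p q} {D E} →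
       FractionalCover M D → FractionalCover N E → FractionalCover (M ⊗ N) (D * E)
_⊗ᶠ_ {m} {n} {p} {q} {M} {N} {D} {E} F G = record
  { size     = F.size * G.size
  ; nonEmpty = m*n≢0 F.size G.size {{F.nonEmpty}} {{G.nonEmpty}}
  ; rows     = F.rows ⊗ G.rows
  ; cols     = F.cols ⊗ G.cols
  ; inside   = inside
  ; dense    = dense
  }
  where
  module F = FractionalCover F
  module G = FractionalCover G

  inside : ∀ l → rect (F.rows ⊗ G.rows) (F.cols ⊗ G.cols) l ⊆ (M ⊗ N)
  inside l x y in-l =
    let in-l₁ , in-l₂ = ∧-true⁻ (trans (sym (∧-interchange (F.rows x₁ l₁) (G.rows x₂ l₂) (F.cols l₁ y₁) (G.cols l₂ y₂))) in-l)
    in cong₂ _∧_ (F.inside l₁ x₁ y₁ in-l₁) (G.inside l₂ x₂ y₂ in-l₂)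
    where
    x₁ = quotient {m} p x
    x₂ = remainder {m} p x
    y₁ = quotient {n} q y
    y₂ = remainder {n} q y
    l₁ = quotient {F.size} G.size l
    l₂ = remainder {F.size} G.size l

  dense : ∀ x y → (M ⊗ N) x y ≡ true → F.size * G.size ≤ D * E * coverCount (F.rows ⊗ G.rows) (F.cols ⊗ G.cols) x y
  dense x y Mxy =
    let M₁ , N₂ = ∧-true⁻ Mxy
    in begin
      F.size * G.size                                                        ≤⟨ *-mono-≤ (F.dense _ _ M₁) (G.dense _ _ N₂) ⟩
      D * coverCount F.rows F.cols _ _ * (E * coverCount G.rows G.cols _ _) ≡⟨ *-interchange D _ E _ ⟩
      D * E * (coverCount F.rows F.cols _ _ * coverCount G.rows G.cols _ _) ≡⟨ cong (D * E *_) (coverCount-⊗ F.rows F.cols G.rows G.cols x y) ⟨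
      D * E * coverCount (F.rows ⊗ G.rows) (F.cols ⊗ G.cols) x y            ∎
    where open ≤-Reasoning

kronPow-fractionalCover : ∀ {n} {M : Mat n n} {D} → FractionalCover M D → ∀ k → FractionalCover (kronPow M k) (D ^ suc k)
kronPow-fractionalCover {D = D} F zero    = subst (FractionalCover _) (sym (*-identityʳ D)) F
kronPow-fractionalCover         F (suc k) = F ⊗ᶠ kronPow-fractionalCover F k

-- Random rectangles in C_n

-- bit k, for k < 2 ^ n, runs through all subsets of Fin n.
bit : ∀ {n} → Fin (2 ^ n) → Fin n → Bool
bit k x = Inverse.to 2↔Bool (finToFun k x)

∑-bit : ∀ {n} (h : Bool → ℕ) (x : Fin n) → 2 * ∑[ k < 2 ^ n ] h (bit k x) ≡ 2 ^ n * (h false + h true)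
∑-bit {suc n} h zero = begin
  2 * ∑[ k < 2 * 2 ^ n ] h (bit {suc n} k zero)              ≡⟨ cong (2 *_) (∑-remQuot 2 {2 ^ n} (h ∘ Inverse.to 2↔Bool ∘ proj₁)) ⟩
  2 * (∑[ j < 2 ^ n ] h false + (∑[ j < 2 ^ n ] h true + 0)) ≡⟨ cong₂ (λ a b → 2 * (a + (b + 0)))
                                                                   (∑-const (2 ^ n) (h false)) (∑-const (2 ^ n) (h true)) ⟩
  2 * (2 ^ n * h false + (2 ^ n * h true + 0))               ≡⟨ rearrange (2 ^ n) (h false) (h true) ⟩
  2 ^ suc n * (h false + h true)                             ∎
  where
  open ≡-Reasoning
  rearrange : ∀ P u v → 2 * (P * u + (P * v + 0)) ≡ 2 * P * (u + v)
  rearrange = solve-∀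
∑-bit {suc n} h (suc x) = begin
  2 * ∑[ k < 2 * 2 ^ n ] h (bit {suc n} k (suc x))           ≡⟨ cong (2 *_) (∑-remQuot 2 {2 ^ n} (λ ij → h (bit (proj₂ ij) x))) ⟩
  2 * (2 * ∑[ j < 2 ^ n ] h (bit j x))                       ≡⟨ cong (2 *_) (∑-bit h x) ⟩
  2 * (2 ^ n * (h false + h true))                           ≡⟨ *-assoc 2 (2 ^ n) _ ⟨
  2 ^ suc n * (h false + h true)                             ∎
  where open ≡-Reasoning

∑-bit-pair : ∀ {n} (g : Bool → Bool → ℕ) (x y : Fin n) → x ≢ y →
             4 * ∑[ k < 2 ^ n ] g (bit k x) (bit k y) ≡
             2 ^ n * (g false false + g false true + (g true false + g true true))
∑-bit-pair         g zero    zero    x≢y = contradiction refl x≢y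
∑-bit-pair {suc n} g zero    (suc y) x≢y = begin
  4 * ∑[ k < 2 * 2 ^ n ] g (bit {suc n} k zero) (bit {suc n} k (suc y))
    ≡⟨ cong (4 *_) (∑-remQuot 2 {2 ^ n} (λ ij → g (Inverse.to 2↔Bool (proj₁ ij)) (bit (proj₂ ij) y))) ⟩
  4 * (Sᶠ + (Sᵗ + 0))                                       ≡⟨ split Sᶠ Sᵗ ⟩
  2 * (2 * Sᶠ) + 2 * (2 * Sᵗ)                               ≡⟨ cong₂ (λ a b → 2 * a + 2 * b) (∑-bit (g false) y) (∑-bit (g true) y) ⟩
  2 * (2 ^ n * (g false false + g false true)) + 2 * (2 ^ n * (g true false + g true true))
    ≡⟨ rearrange (2 ^ n) (g false false) (g false true) (g true false) (g true true) ⟩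
  2 ^ suc n * (g false false + g false true + (g true false + g true true)) ∎
  where
  open ≡-Reasoning
  Sᶠ = ∑[ j < 2 ^ n ] g false (bit j y)
  Sᵗ = ∑[ j < 2 ^ n ] g true (bit j y)
  split : ∀ u v → 4 * (u + (v + 0)) ≡ 2 * (2 * u) + 2 * (2 * v)
  split = solve-∀
  rearrange : ∀ P a b c d → 2 * (P * (a + b)) + 2 * (P * (c + d)) ≡ 2 * P * (a + b + (c + d))
  rearrange = solve-∀
∑-bit-pair {suc n} g (suc x) zero    x≢y =
  trans (∑-bit-pair (flip g) zero (suc x) (x≢y ∘ sym))
        (cong (2 ^ suc n *_) (+-interchange (g false false) (g true false) (g false true) (g true true)))
∑-bit-pair {suc n} g (suc x) (suc y) x≢y = begin
  4 * ∑[ k < 2 * 2 ^ n ] g (bit {suc n} k (suc x)) (bit {suc n} k (suc y))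
    ≡⟨ cong (4 *_) (∑-remQuot 2 {2 ^ n} (λ ij → g (bit (proj₂ ij) x) (bit (proj₂ ij) y))) ⟩
  4 * (2 * S)                  ≡⟨ swap S ⟩
  2 * (4 * S)                  ≡⟨ cong (2 *_) (∑-bit-pair g x y (x≢y ∘ cong suc)) ⟩
  2 * (2 ^ n * G)              ≡⟨ *-assoc 2 (2 ^ n) G ⟨
  2 ^ suc n * G                ∎
  where
  open ≡-Reasoning
  S = ∑[ j < 2 ^ n ] g (bit j x) (bit j y)
  G = g false false + g false true + (g true false + g true true)
  swap : ∀ S → 4 * (2 * S) ≡ 2 * (4 * S)
  swap = solve-∀

Cmat-diag : ∀ {n} (i : Fin n) → Cmat n i i ≡ false
Cmat-diag i = cong not (trans (isYes≗does (i ≟ i)) (dec-true (i ≟ i) refl))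

Cmat-offDiag : ∀ {n} {i j : Fin n} → i ≢ j → Cmat n i j ≡ true
Cmat-offDiag {i = i} {j} i≢j = cong not (trans (isYes≗does (i ≟ j)) (dec-false (i ≟ j) i≢j))

Cmat-fractionalCover : ∀ n → FractionalCover (Cmat n) 4
Cmat-fractionalCover n = record
  { size     = 2 ^ n
  ; nonEmpty = m^n≢0 2 n
  ; rows     = rows
  ; cols     = cols
  ; inside   = λ k x y in-k → Cmat-offDiag λ { refl → contradiction (trans (sym (∧-inverseˡ (bit k x))) in-k) λ () }
  ; dense    = dense
  }
  where
  rows : Mat n (2 ^ n)
  rows x k = not (bit k x)
  cols : Mat (2 ^ n) n
  cols k y = bit k y

  dense : ∀ x y → Cmat n x y ≡ true → 2 ^ n ≤ 4 * coverCount rows cols x y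
  dense x y Cxy = ≤-reflexive (sym (trans (∑-bit-pair (λ b c → ⟦ not b ∧ c ⟧) x y x≢y) (*-identityʳ (2 ^ n))))
    where
    x≢y : x ≢ y
    x≢y refl = contradiction (trans (sym Cxy) (Cmat-diag x)) λ ()

-- Greedy rounding

module Greedy {m n} {M : Mat m n} {a : ℕ} (F : FractionalCover M (suc a)) where
  open FractionalCover F

  covered : ∀ {j} → (Fin j → Fin size) → Mat m n
  covered σ = (λ x i → rows x (σ i)) ⊙ (λ i y → cols (σ i) y)

  removal-shrinks : ∀ {u w c} → u ≡ w + c → u ≤ suc a * c → suc a * w ≤ a * u
  removal-shrinks {w = w} {c} refl w+c≤ = begin
    w + a * w       ≡⟨ +-comm w (a * w) ⟩
    a * w + w       ≤⟨ +-monoʳ-≤ (a * w) (+-cancelʳ-≤ c w (a * c) (≤-trans w+c≤ (≤-reflexive (+-comm c (a * c))))) ⟩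
    a * w + a * c   ≡⟨ *-distribˡ-+ a w c ⟨
    a * (w + c)     ∎
    where open ≤-Reasoning

  averaging : ∀ U → U ⊆ M → ones U * size ≤ ∑[ l < size ] (suc a * ones (U ∩ rect rows cols l))
  averaging U U⊆M = begin
    ones U * size                                                    ≡⟨ *-distribʳ-sum size (λ x → ∑[ y < n ] ⟦ U x y ⟧) ⟩
    ∑[ x < m ] ((∑[ y < n ] ⟦ U x y ⟧) * size)                        ≡⟨ sum-cong-≗ (λ x → *-distribʳ-sum size (λ y → ⟦ U x y ⟧)) ⟩
    ∑[ x < m ] ∑[ y < n ] (⟦ U x y ⟧ * size)                          ≤⟨ ∑-mono-≤ (λ x → ∑-mono-≤ (pointwise x)) ⟩
    ∑[ x < m ] ∑[ y < n ] (suc a * (⟦ U x y ⟧ * coverCount rows cols x y))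
      ≡⟨ trans (*-distribˡ-sum (suc a) (λ x → ∑[ y < n ] (⟦ U x y ⟧ * coverCount rows cols x y)))
               (sum-cong-≗ λ x → *-distribˡ-sum (suc a) (λ y → ⟦ U x y ⟧ * coverCount rows cols x y)) ⟨
    suc a * ∑[ x < m ] ∑[ y < n ] (⟦ U x y ⟧ * coverCount rows cols x y) ≡⟨ cong (suc a *_) (∑-ones-∩-rect U rows cols) ⟨
    suc a * ∑[ l < size ] ones (U ∩ rect rows cols l)                 ≡⟨ *-distribˡ-sum (suc a) (λ l → ones (U ∩ rect rows cols l)) ⟩
    ∑[ l < size ] (suc a * ones (U ∩ rect rows cols l))               ∎
    where
    open ≤-Reasoning
    pointwise : ∀ x y → ⟦ U x y ⟧ * size ≤ suc a * (⟦ U x y ⟧ * coverCount rows cols x y)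
    pointwise x y with U x y in Uxy
    ... | false = z≤n
    ... | true  = subst₂ _≤_ (sym (+-identityʳ size)) (cong (suc a *_) (sym (+-identityʳ _))) (dense x y (U⊆M x y Uxy))

  greedy-step : ∀ U → U ⊆ M → ∃ λ l → suc a * ones (U ∖ rect rows cols l) ≤ a * ones U
  greedy-step U U⊆M =
    let l , U≤D*U∩l = max-≥-mean {{nonEmpty}} (ones U) (λ l → suc a * ones (U ∩ rect rows cols l)) (averaging U U⊆M)
    in l , removal-shrinks (ones-∖-∩ U (rect rows cols l)) U≤D*U∩l

  greedy : ∀ j → ∃ λ (σ : Fin j → Fin size) → suc a ^ j * ones (M ∖ covered σ) ≤ a ^ j * ones M
  greedy zero    = (λ ()) , ≤-reflexive (cong (1 *_) (ones-cong λ x y → ∧-identityʳ (M x y)))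
  greedy (suc j) =
    let σ , σ-bound = greedy j
        U = M ∖ covered σ
        l , l-bound = greedy-step U (λ x y → proj₁ ∘ ∧-true⁻)
    in l ∷ σ , (begin
      suc a ^ suc j * ones (M ∖ covered (l ∷ σ))        ≡⟨ cong (suc a ^ suc j *_) (ones-cong λ x y →
                                                             ∧-not-∨ (M x y) (rect rows cols l x y) (covered σ x y)) ⟩
      suc a * suc a ^ j * ones (U ∖ rect rows cols l)   ≡⟨ *-assoc (suc a) (suc a ^ j) _ ⟩
      suc a * (suc a ^ j * ones (U ∖ rect rows cols l)) ≡⟨ x∙yz≈y∙xz (suc a) (suc a ^ j) _ ⟩
      suc a ^ j * (suc a * ones (U ∖ rect rows cols l)) ≤⟨ *-monoʳ-≤ (suc a ^ j) l-bound ⟩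
      suc a ^ j * (a * ones U)                          ≡⟨ x∙yz≈y∙xz (suc a ^ j) a _ ⟩
      a * (suc a ^ j * ones U)                          ≤⟨ *-monoʳ-≤ a σ-bound ⟩
      a * (a ^ j * ones M)                              ≡⟨ *-assoc a (a ^ j) _ ⟨
      a ^ suc j * ones M                                ∎)
    where
    open ≤-Reasoning
    ∧-not-∨ : ∀ u r c → u ∧ not (r ∨ c) ≡ (u ∧ not c) ∧ not r
    ∧-not-∨ false _     _ = refl
    ∧-not-∨ true  false c = sym (∧-identityʳ (not c))
    ∧-not-∨ true  true  c = sym (∧-zeroʳ (not c))

  boolFactors : ∀ {t} → ones M < 2 ^ t → BoolFactors M (suc a * t)
  boolFactors {t} ones<2^t = (λ x i → rows x (σ i)) , (λ i y → cols (σ i) y) , M≡covered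
    where
    σ : Fin (suc a * t) → Fin size
    σ = proj₁ (greedy (suc a * t))

    nothing-uncovered : ones (M ∖ covered σ) ≡ 0
    nothing-uncovered = p*u≤q*v<q*w≤p⇒u≡0 {q = a ^ (suc a * t)} {{m^n≢0 (suc a) (suc a * t)}}
      (proj₂ (greedy (suc a * t))) ones<2^t (a^[[1+a]t]*2^t≤[1+a]^[[1+a]t] a t)

    M≡covered : ∀ x y → M x y ≡ covered σ x y
    M≡covered x y with M x y in Mxy | covered σ x y in σxy
    ... | true  | true  = refl
    ... | false | false = refl
    ... | true  | false = contradiction (subst (0 <_) nothing-uncovered
                            (ones-pos (M ∖ covered σ) x y (cong₂ (λ u c → u ∧ not c) Mxy σxy))) λ ()
    ... | false | true  = let i , in-i = bigOr-true _ _ σxy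
                          in contradiction (trans (sym Mxy) (inside (σ i) x y in-i)) λ ()

fractionalCover⇒boolFactors : ∀ {m n} {M : Mat m n} {D t} .{{_ : NonZero D}} →
                              FractionalCover M D → ones M < 2 ^ t → BoolFactors M (D * t)
fractionalCover⇒boolFactors {D = suc a} F = Greedy.boolFactors F

-- The rank bound

boolFactors-Cmat⇒n≤2^r : ∀ {n r} → BoolFactors (Cmat n) r → n ≤ 2 ^ r
boolFactors-Cmat⇒n≤2^r {n} {r} (A , B , C≡A⊙B) = injective⇒≤ {f = code} code-injective
  where
  open Inverse 2↔Bool using (to; from; strictlyInverseˡ)

  code : Fin n → Fin (2 ^ r)
  code i = funToFin (from ∘ A i)

  code⇒rows≡ : ∀ {i j} → code i ≡ code j → ∀ l → A i l ≡ A j l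
  code⇒rows≡ {i} {j} eq l = begin
    A i l                     ≡⟨ strictlyInverseˡ (A i l) ⟨
    to (from (A i l))         ≡⟨ cong to (finToFun-funToFin (from ∘ A i) l) ⟨
    to (finToFun (code i) l)  ≡⟨ cong (λ c → to (finToFun c l)) eq ⟩
    to (finToFun (code j) l)  ≡⟨ cong to (finToFun-funToFin (from ∘ A j) l) ⟩
    to (from (A j l))         ≡⟨ strictlyInverseˡ (A j l) ⟩
    A j l                     ∎
    where open ≡-Reasoning

  code-injective : ∀ {i j} → code i ≡ code j → i ≡ j
  code-injective {i} {j} eq with i ≟ j
  ... | yes i≡j = i≡j
  ... | no  i≢j = contradiction (begin
    true          ≡⟨ Cmat-offDiag i≢j ⟨
    Cmat n i j    ≡⟨ C≡A⊙B i j ⟩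
    (A ⊙ B) i j   ≡⟨ bigOr-cong (λ l → cong (_∧ B l j) (code⇒rows≡ eq l)) ⟩
    (A ⊙ B) j j   ≡⟨ C≡A⊙B j j ⟨
    Cmat n j j    ≡⟨ Cmat-diag j ⟩
    false         ∎) λ ()
    where open ≡-Reasoning

kdim-≤ : ∀ {n P} → n ≤ P → ∀ k → kdim n k ≤ P ^ suc k
kdim-≤ {P = P} n≤P zero    = ≤-trans n≤P (≤-reflexive (sym (*-identityʳ P)))
kdim-≤         n≤P (suc k) = *-mono-≤ n≤P (kdim-≤ n≤P k)

rank-kronPow-Cmat-≤ : ∀ {n r s} k → 2 ≤ n → BoolFactors (Cmat n) r → HasBoolRank (kronPow (Cmat n) k) s →
                      s ≤ 3 * 8 ^ suc k * r
rank-kronPow-Cmat-≤ {n} {r} {s} k 2≤n factors-r (_ , minimal) = begin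
  s                          ≤⟨ minimal _ (fractionalCover⇒boolFactors {{m^n≢0 4 K}} cover ones<2^[1+2E]) ⟩
  4 ^ K * suc (E + E)        ≤⟨ 4^K*[1+2rK]≤3*8^K*r r K 1≤r (s≤s z≤n) ⟩
  3 * 8 ^ K * r              ∎
  where
  open ≤-Reasoning
  K = suc k
  E = r * K
  N = kdim n k

  n≤2^r : n ≤ 2 ^ r
  n≤2^r = boolFactors-Cmat⇒n≤2^r factors-r

  1≤r : 1 ≤ r
  1≤r = n≢0⇒n>0 λ { refl → contradiction (≤-trans 2≤n n≤2^r) λ { (s≤s ()) } }

  cover : FractionalCover (kronPow (Cmat n) k) (4 ^ K)
  cover = kronPow-fractionalCover (Cmat-fractionalCover n) k

  ones<2^[1+2E] : ones (kronPow (Cmat n) k) < 2 ^ suc (E + E)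
  ones<2^[1+2E] = begin-strict
    ones (kronPow (Cmat n) k)  ≤⟨ ones-≤ (kronPow (Cmat n) k) ⟩
    N * N                      ≤⟨ *-mono-≤ N≤2^E N≤2^E ⟩
    2 ^ E * 2 ^ E              ≡⟨ ^-distribˡ-+-* 2 E E ⟨
    2 ^ (E + E)                <⟨ ^-monoʳ-< 2 (s≤s (s≤s z≤n)) (n<1+n (E + E)) ⟩
    2 ^ suc (E + E)            ∎
    where
    N≤2^E : N ≤ 2 ^ E
    N≤2^E = subst (N ≤_) (^-*-assoc 2 r K) (kdim-≤ n≤2^r k)

toℚ≡mkℚ : ∀ a → toℚ a ≡ mkℚ (ℤ.+ a) 0 (coprime-sym (1-coprimeTo a))
toℚ≡mkℚ a = ℚP.normalize-coprime (coprime-sym (1-coprimeTo a))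

toℚ-* : ∀ a b → toℚ a ℚ.* toℚ b ≡ toℚ (a * b)
toℚ-* a b rewrite toℚ≡mkℚ a | toℚ≡mkℚ b = cong (ℚ._/ 1) (sym (ℤP.pos-* a b))

toℚ-^ : ∀ c k → toℚ c ^ℚ k ≡ toℚ (c ^ k)
toℚ-^ c zero    = refl
toℚ-^ c (suc k) = trans (cong (toℚ c ℚ.*_) (toℚ-^ c k)) (toℚ-* c (c ^ k))

toℚ-mono-≤ : ∀ {a b} → a ≤ b → toℚ a ℚ.≤ toℚ b
toℚ-mono-≤ {a} {b} a≤b rewrite toℚ≡mkℚ a | toℚ≡mkℚ b =
  ℚ.*≤* (subst₂ ℤ._≤_ (sym (ℤP.*-identityʳ (ℤ.+ a))) (sym (ℤP.*-identityʳ (ℤ.+ b))) (ℤ.+≤+ a≤b))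

mainTheorem15 : Σ ℚ λ c → Σ ℚ λ C → (1ℚ ℚ.< c) × (0ℚ ℚ.< C) ×
    ((n k : ℕ) → 2 ≤ n → 1 ≤ k → (r s : ℕ) →
      HasBoolRank (Cmat n) r → HasBoolRank (kronPow (Cmat n) (ℕ.pred k)) s →
      toℚ s ℚ.≤ C ℚ.* (c ^ℚ k) ℚ.* toℚ r)
mainTheorem15 = toℚ 8 , toℚ 3 , toWitness {a? = 1ℚ ℚP.<? toℚ 8} tt , toWitness {a? = 0ℚ ℚP.<? toℚ 3} tt , bound
  where
  bound : (n k : ℕ) → 2 ≤ n → 1 ≤ k → (r s : ℕ) →
          HasBoolRank (Cmat n) r → HasBoolRank (kronPow (Cmat n) (ℕ.pred k)) s →
          toℚ s ℚ.≤ toℚ 3 ℚ.* (toℚ 8 ^ℚ k) ℚ.* toℚ r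
  bound n (suc k) 2≤n _ r s (factors-r , _) rank-s =
    subst (toℚ s ℚ.≤_) (sym toℚ-bound) (toℚ-mono-≤ (rank-kronPow-Cmat-≤ k 2≤n factors-r rank-s))
    where
    toℚ-bound : toℚ 3 ℚ.* (toℚ 8 ^ℚ suc k) ℚ.* toℚ r ≡ toℚ (3 * 8 ^ suc k * r)
    toℚ-bound = begin
      toℚ 3 ℚ.* (toℚ 8 ^ℚ suc k) ℚ.* toℚ r     ≡⟨ cong (λ q → toℚ 3 ℚ.* q ℚ.* toℚ r) (toℚ-^ 8 (suc k)) ⟩
      toℚ 3 ℚ.* toℚ (8 ^ suc k) ℚ.* toℚ r      ≡⟨ cong (ℚ._* toℚ r) (toℚ-* 3 (8 ^ suc k)) ⟩
      toℚ (3 * 8 ^ suc k) ℚ.* toℚ r            ≡⟨ toℚ-* (3 * 8 ^ suc k) r ⟩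
      toℚ (3 * 8 ^ suc k * r)                  ∎
      where open ≡-Reasoning
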